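{- For every integer $k\geq 2$, the board $[20]\times[10k]$ admits a $(2,5)$ knight's tour.
   Context: $[m]=\{0,\dots,m-1\}$. The $(2,5)$ knight's graph on $[p]\times[q]$ has vertex set $[p]\times[q]$, with $(x,y)\sim(x',y')$ iff $\{|x-x'|,|y-y'|\}=\{2,5\}$; a $(2,5)$ knight's tour is a Hamiltonian cycle of it. -}

module Defs where

open import Data.Nat using (ℕ; zero; suc; _*_; ∣_-_∣)
open import Data.Fin using (Fin; toℕ; inject₁; fromℕ)
open import Data.Product using (_×_; Σ; _,_)
open import Data.Sum using (_⊎_)
open import Relation.Binary.PropositionalEquality using (_≡_)
open import Function.Bundles using (_⤖_; Bijection)

Knight25Adj : ∀ {p q} → Fin p × Fin q → Fin p × Fin q → Set
Knight25Adj (x , y) (x' , y') =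
  (∣ toℕ x - toℕ x' ∣ ≡ 2 × ∣ toℕ y - toℕ y' ∣ ≡ 5)
  ⊎ (∣ toℕ x - toℕ x' ∣ ≡ 5 × ∣ toℕ y - toℕ y' ∣ ≡ 2)

record HamiltonianCycle (V : Set) (Adj : V → V → Set) : Set where
  field
    m     : ℕ                       -- the cycle length is n = m + 3
    order : Fin (suc (suc (suc m))) ⤖ V
  v : Fin (suc (suc (suc m))) → V
  v = Bijection.to order
  field
    step  : (i : Fin (suc (suc m))) → Adj (v (inject₁ i)) (v (Data.Fin.suc i))
    close : Adj (v (fromℕ (suc (suc m)))) (v Fin.zero)

Knight25Tour : ℕ → ℕ → Set
Knight25Tour p q = HamiltonianCycle (Fin p × Fin q) Knight25Adj

-- A 20 × 20 block is covered by two disjoint (2,5)-knight paths, a front path from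
-- (14,3) to (16,18) and a back path from (4,19) to (9,1), with the property that a
-- Hamiltonian knight path from (14,3) to (9,1) on [20] × [q], shifted by 20 in the second
-- coordinate, fits between them: (16,18) is a knight's move from (14,23) and (9,21) one
-- from (4,19). Front, shifted path, back is then a Hamiltonian path from (14,3) to (9,1)
-- on [20] × [20 + q]. Starting from such paths on [20] × [20] and [20] × [30] this covers
-- every [20] × [10k] with k ≥ 2, and each path closes to a tour because (9,1) and (14,3)
-- are a knight's move apart.

module Submission where

open import Defs
open import Data.Nat using (ℕ; _*_; _≤_)
open import Data.Nat using (suc; _+_; _<_; _≟_; _<?_; ∣_-_∣; z≤n; s≤s)
open import Data.Nat.Properties
  using (∣m+n-m+o∣≡∣n-o∣; +-cancelˡ-≡; +-monoʳ-<; <-≤-trans; m≤m+n; m+n≮m; *-distribˡ-+)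
open import Data.Fin using (Fin; zero; suc; toℕ; fromℕ; fromℕ<; inject₁; splitAt; join)
open import Data.Fin.Properties using (toℕ-fromℕ<; toℕ-injective; toℕ-↑ˡ; toℕ-↑ʳ; join-splitAt)
import Data.Fin.Properties as Fin
open import Data.Product using (_×_; Σ; _,_; proj₁; proj₂)
open import Data.Product.Properties using (≡-dec)
open import Data.Sum using (_⊎_; inj₁; inj₂)
open import Data.Maybe using (just; nothing)
import Data.Maybe as Maybe
import Data.Maybe.Properties as Maybe
open import Data.Maybe.Relation.Binary.Connected
  using (Connected; just; just-nothing; nothing-just; nothing; drop-just)
open import Data.List using (List; []; _∷_; _++_; map; head; last; length; lookup)
open import Data.List.Properties using (head-map; last-map; length-map)
open import Data.List.Membership.Propositional using (_∈_)
open import Data.List.Membership.Propositional.Properties using (∈-lookup; ∈-map⁺; ∈-map⁻; ∈-++⁺ˡ; ∈-++⁺ʳ)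
open import Data.List.Relation.Unary.All as All using (All; all?)
import Data.List.Relation.Unary.All.Properties as All
open import Data.List.Relation.Unary.Linked as Linked using (Linked; _∷_; linked?)
import Data.List.Relation.Unary.Linked.Properties as Linked
open import Data.List.Relation.Unary.Unique.Propositional using (Unique; _∷_)
import Data.List.Relation.Unary.Unique.Propositional.Properties as Unique
import Data.List.Relation.Unary.Unique.DecPropositional as DecUnique
import Data.List.Membership.DecPropositional as DecMembership
open import Data.List.Relation.Unary.Enumerates.Setoid.Properties using (lookup-surjective)
open import Data.List.Relation.Binary.Disjoint.Propositional using (Disjoint)
open import Data.List.Relation.Binary.Permutation.Setoid using (_↭_)
import Data.List.Relation.Binary.Permutation.Setoid.Properties as Perm
open import Data.Empty using (⊥-elim)
open import Function using (_on_)
open import Function.Bundles using (mk⤖)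
open import Function.Definitions using (Injective)
open import Relation.Binary.Core using (_⇒_)
open import Relation.Binary.Definitions using (Decidable; DecidableEquality; _Respects_)
open import Relation.Binary.PropositionalEquality using (_≡_; refl; sym; trans; cong; cong₂; subst; subst₂; setoid)
import Relation.Unary as U
open import Relation.Nullary.Decidable using (_×-dec_; _⊎-dec_; from-yes)

module _ {A : Set} where

  head-++ : ∀ {xs ys : List A} {x} → head xs ≡ just x → head (xs ++ ys) ≡ just x
  head-++ {_ ∷ _} eq = eq

  last-++ : ∀ xs {ys : List A} {y} → last ys ≡ just y → last (xs ++ ys) ≡ just y
  last-++ []            eq = eq
  last-++ (_ ∷ [])      {_ ∷ _} eq = eq
  last-++ (_ ∷ x ∷ xs)  eq = last-++ (x ∷ xs) eq

  last-lookup : ∀ (x : A) xs → last (x ∷ xs) ≡ just (lookup (x ∷ xs) (fromℕ (length xs)))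
  last-lookup x []       = refl
  last-lookup x (y ∷ ys) = last-lookup y ys

  lookup-injective : ∀ {xs : List A} → Unique xs → Injective _≡_ _≡_ (lookup xs)
  lookup-injective {_ ∷ _} _        {zero}  {zero}  _  = refl
  lookup-injective (x≢ ∷ _) {zero}  {suc j} eq = ⊥-elim (All.lookup x≢ (∈-lookup j) eq)
  lookup-injective (x≢ ∷ _) {suc i} {zero}  eq = ⊥-elim (All.lookup x≢ (∈-lookup i) (sym eq))
  lookup-injective (_ ∷ u)  {suc i} {suc j} eq = cong suc (lookup-injective u eq)

  lookup-linked : ∀ {R : A → A → Set} {x xs} → Linked R (x ∷ xs) →
                  (i : Fin (length xs)) → R (lookup (x ∷ xs) (inject₁ i)) (lookup (x ∷ xs) (suc i))
  lookup-linked (r ∷ _)  zero    = r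
  lookup-linked (_ ∷ rs) (suc i) = lookup-linked rs i

  Connected-map⁻ : ∀ {B : Set} {R : B → B → Set} {f : A → B} {m n} →
                   Connected R (Maybe.map f m) (Maybe.map f n) → Connected (R on f) m n
  Connected-map⁻ {m = just _}  {just _}  (just r) = just r
  Connected-map⁻ {m = just _}  {nothing} _        = just-nothing
  Connected-map⁻ {m = nothing} {just _}  _        = nothing-just
  Connected-map⁻ {m = nothing} {nothing} _        = nothing

hamiltonianCycle : ∀ {V : Set} {_~_ : V → V → Set} (vs : List V) → 3 ≤ length vs →
                   Linked _~_ vs → Connected _~_ (last vs) (head vs) →
                   Unique vs → (∀ v → v ∈ vs) → HamiltonianCycle V _~_
hamiltonianCycle {_~_ = _~_} vs@(a ∷ b ∷ c ∷ rest) _ linked closed unique complete = record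
  { m     = length rest
  ; order = mk⤖ (lookup-injective unique , lookup-surjective (setoid _) complete)
  ; step  = lookup-linked linked
  ; close = drop-just (subst (λ l → Connected _~_ l (just a)) (last-lookup a (b ∷ c ∷ rest)) closed)
  }
hamiltonianCycle (_ ∷ [])     (s≤s ())
hamiltonianCycle (_ ∷ _ ∷ []) (s≤s (s≤s ()))

Cell : Set
Cell = ℕ × ℕ

_≟ᶜ_ : DecidableEquality Cell
_≟ᶜ_ = ≡-dec _≟_ _≟_

open DecUnique _≟ᶜ_ using (unique?)
open DecMembership _≟ᶜ_ using (_∈?_)

KnightMove : ℕ → ℕ → Set
KnightMove dx dy = (dx ≡ 2 × dy ≡ 5) ⊎ (dx ≡ 5 × dy ≡ 2)

-- Same shape as Knight25Adj, so that Knight25Adj a b is definitionally Knight (coords a) (coords b).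
Knight : Cell → Cell → Set
Knight (x , y) (x′ , y′) = KnightMove ∣ x - x′ ∣ ∣ y - y′ ∣

knight? : Decidable Knight
knight? (x , y) (x′ , y′) =
  ((∣ x - x′ ∣ ≟ 2) ×-dec (∣ y - y′ ∣ ≟ 5)) ⊎-dec ((∣ x - x′ ∣ ≟ 5) ×-dec (∣ y - y′ ∣ ≟ 2))

shiftʸ : ℕ → Cell → Cell
shiftʸ w (x , y) = x , w + y

shiftʸ-injective : ∀ w → Injective _≡_ _≡_ (shiftʸ w)
shiftʸ-injective w eq = cong₂ _,_ (cong proj₁ eq) (+-cancelˡ-≡ w _ _ (cong proj₂ eq))

Knight-shiftʸ : ∀ w → Knight ⇒ (Knight on shiftʸ w)
Knight-shiftʸ w {x , y} {x′ , y′} = subst (KnightMove ∣ x - x′ ∣) (sym (∣m+n-m+o∣≡∣n-o∣ w y y′))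

Linked-shiftʸ : ∀ w {cs} → Linked Knight cs → Linked Knight (map (shiftʸ w) cs)
Linked-shiftʸ w linked = Linked.map⁺ (Linked.map (λ {a} {b} → Knight-shiftʸ w {a} {b}) linked)

coords : ∀ {p q} → Fin p × Fin q → Cell
coords (x , y) = toℕ x , toℕ y

coords-injective : ∀ {p q} → Injective _≡_ _≡_ (coords {p} {q})
coords-injective eq = cong₂ _,_ (toℕ-injective (cong proj₁ eq)) (toℕ-injective (cong proj₂ eq))

InBoard : ℕ → ℕ → Cell → Set
InBoard p q (x , y) = x < p × y < q

Covers : ℕ → ℕ → List Cell → Set
Covers p q cs = (x : Fin p) (y : Fin q) → (toℕ x , toℕ y) ∈ cs

EnumeratesBoard : ℕ → ℕ → List Cell → Set
EnumeratesBoard p q cs = All (InBoard p q) cs × Unique cs × Covers p q cs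

KnightPath : Cell → Cell → List Cell → Set
KnightPath s e cs = Linked Knight cs × head cs ≡ just s × last cs ≡ just e

HamiltonianKnightPath : ℕ → ℕ → Cell → Cell → Set
HamiltonianKnightPath p q s e = Σ (List Cell) λ cs → KnightPath s e cs × EnumeratesBoard p q cs

toBoard : ∀ {p q cs} → All (InBoard p q) cs → List (Fin p × Fin q)
toBoard All.[]                  = []
toBoard ((x<p , y<q) All.∷ bs) = (fromℕ< x<p , fromℕ< y<q) ∷ toBoard bs

coords-toBoard : ∀ {p q cs} (bs : All (InBoard p q) cs) → map coords (toBoard bs) ≡ cs
coords-toBoard All.[]                  = refl
coords-toBoard ((x<p , y<q) All.∷ bs) =
  cong₂ _∷_ (cong₂ _,_ (toℕ-fromℕ< x<p) (toℕ-fromℕ< y<q)) (coords-toBoard bs)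

knightCycle : ∀ {p q s e cs} (vs : List (Fin p × Fin q)) → map coords vs ≡ cs →
              3 ≤ length cs → KnightPath s e cs → EnumeratesBoard p q cs →
              Knight e s → Knight25Tour p q
knightCycle vs refl long (linked , head≡ , last≡) (_ , unique , covers) e~s =
  hamiltonianCycle vs (subst (3 ≤_) (length-map coords vs) long)
    (Linked.map⁻ linked) (Connected-map⁻ closed) (Unique.map⁻ unique) complete
  where
  closed : Connected Knight (Maybe.map coords (last vs)) (Maybe.map coords (head vs))
  closed = subst₂ (Connected Knight)
    (trans (sym last≡) (last-map coords vs)) (trans (sym head≡) (head-map vs)) (just e~s)
  complete : ∀ c → c ∈ vs
  complete c with ∈-map⁻ coords (covers (proj₁ c) (proj₂ c))
  ... | c′ , c′∈vs , eq = subst (_∈ vs) (sym (coords-injective eq)) c′∈vs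

knightTour : ∀ {p q s e} (path : HamiltonianKnightPath p q s e) → 3 ≤ length (proj₁ path) →
             Knight e s → Knight25Tour p q
knightTour (_ , path , enum@(inBoard , _)) long =
  knightCycle (toBoard inBoard) (coords-toBoard inBoard) long path enum

EnumeratesBoard-resp-↭ : ∀ {p q} → EnumeratesBoard p q Respects _↭_ (setoid Cell)
EnumeratesBoard-resp-↭ {p} {q} π (inBoard , unique , covers) =
  Perm.All-resp-↭ (setoid Cell) (subst (InBoard p q)) π inBoard ,
  Perm.Unique-resp-↭ (setoid Cell) π unique ,
  λ x y → Perm.∈-resp-↭ (setoid Cell) π (covers x y)

EnumeratesBoard-beside : ∀ {p} w {q bs cs} → EnumeratesBoard p w bs → EnumeratesBoard p q cs →
                         EnumeratesBoard p (w + q) (map (shiftʸ w) cs ++ bs)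
EnumeratesBoard-beside {p} w {q} {bs} {cs}
  (bsIn , bsUnique , bsCovers) (csIn , csUnique , csCovers) =
  All.++⁺ (All.map⁺ (All.map shiftIn csIn)) (All.map widenIn bsIn) ,
  Unique.++⁺ (Unique.map⁺ (shiftʸ-injective w) csUnique) bsUnique disjoint ,
  λ x y → subst (λ y → (toℕ x , toℕ y) ∈ _) (join-splitAt w q y) (covers x (splitAt w y))
  where
  shiftIn : ∀ {c} → InBoard p q c → InBoard p (w + q) (shiftʸ w c)
  shiftIn (x<p , y<q) = x<p , +-monoʳ-< w y<q
  widenIn : ∀ {c} → InBoard p w c → InBoard p (w + q) c
  widenIn (x<p , y<w) = x<p , <-≤-trans y<w (m≤m+n w q)
  disjoint : Disjoint (map (shiftʸ w) cs) bs
  disjoint (v∈cs , v∈bs) with ∈-map⁻ (shiftʸ w) v∈cs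
  ... | c , _ , refl = m+n≮m w (proj₂ c) (proj₂ (All.lookup bsIn v∈bs))
  covers : ∀ x (y : Fin w ⊎ Fin q) → (toℕ x , toℕ (join w q y)) ∈ map (shiftʸ w) cs ++ bs
  covers x (inj₁ y) rewrite toℕ-↑ˡ y q = ∈-++⁺ʳ (map (shiftʸ w) cs) (bsCovers x y)
  covers x (inj₂ y) rewrite toℕ-↑ʳ w y = ∈-++⁺ˡ (∈-map⁺ (shiftʸ w) (csCovers x y))

splice : ℕ → List Cell → List Cell → List Cell → List Cell
splice w front cs back = front ++ map (shiftʸ w) cs ++ back

KnightPath-splice : ∀ w {s f b e s′ e′ front back cs} →
                    KnightPath s f front → KnightPath b e back → KnightPath s′ e′ cs →
                    Knight f (shiftʸ w s′) → Knight (shiftʸ w e′) b →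
                    KnightPath s e (splice w front cs back)
KnightPath-splice w {front = front} {back} {cs} (frontLinked , frontHead , frontLast)
  (backLinked , backHead , backLast) (csLinked , csHead , csLast) enter leave =
  Linked.++⁺ frontLinked entering
    (Linked.++⁺ (Linked-shiftʸ w csLinked) leaving backLinked) ,
  head-++ frontHead ,
  last-++ front (last-++ (map (shiftʸ w) cs) backLast)
  where
  entering : Connected Knight (last front) (head (map (shiftʸ w) cs ++ back))
  entering = subst₂ (Connected Knight) (sym frontLast)
    (sym (head-++ (trans (head-map cs) (cong (Maybe.map (shiftʸ w)) csHead)))) (just enter)
  leaving : Connected Knight (last (map (shiftʸ w) cs)) (head back)
  leaving = subst₂ (Connected Knight)
    (sym (trans (last-map (shiftʸ w) cs) (cong (Maybe.map (shiftʸ w)) csLast)))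
    (sym backHead) (just leave)

EnumeratesBoard-splice : ∀ {p} w {q front back cs} →
                         EnumeratesBoard p w (front ++ back) → EnumeratesBoard p q cs →
                         EnumeratesBoard p (w + q) (splice w front cs back)
EnumeratesBoard-splice w {front = front} {cs = cs} block enum =
  EnumeratesBoard-resp-↭ (Perm.shifts (setoid Cell) (map (shiftʸ w) cs) front)
    (EnumeratesBoard-beside w block enum)

HamiltonianKnightPath-splice : ∀ {p} w {q s f b e s′ e′ front back} →
                               KnightPath s f front → KnightPath b e back →
                               EnumeratesBoard p w (front ++ back) →
                               Knight f (shiftʸ w s′) → Knight (shiftʸ w e′) b →
                               HamiltonianKnightPath p q s′ e′ → HamiltonianKnightPath p (w + q) s e
HamiltonianKnightPath-splice w {front = front} {back} frontPath backPath block enter leave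
  (cs , path , enum) =
  splice w front cs back ,
  KnightPath-splice w frontPath backPath path enter leave ,
  EnumeratesBoard-splice w {front = front} {back} block enum

enumeratesBoard? : ∀ p q → U.Decidable (EnumeratesBoard p q)
enumeratesBoard? p q cs =
  all? (λ { (x , y) → (x <? p) ×-dec (y <? q) }) cs ×-dec unique? cs ×-dec
  Fin.all? λ x → Fin.all? λ y → (toℕ x , toℕ y) ∈? cs

knightPath? : ∀ s e → U.Decidable (KnightPath s e)
knightPath? s e cs =
  linked? knight? cs ×-dec
  Maybe.≡-dec _≟ᶜ_ (head cs) (just s) ×-dec Maybe.≡-dec _≟ᶜ_ (last cs) (just e)

start end : Cell
start = 14 , 3
end   = 9 , 1

blockFront : List Cell
blockFront =
  (14 , 3) ∷ (19 , 1) ∷ (17 , 6) ∷ (15 , 1) ∷ (10 , 3) ∷ (8 , 8) ∷ (10 , 13) ∷ (8 , 18) ∷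
  (3 , 16) ∷ (1 , 11) ∷ (6 , 9) ∷ (4 , 4) ∷ (9 , 2) ∷ (4 , 0) ∷ (2 , 5) ∷ (0 , 0) ∷ (5 , 2) ∷
  (0 , 4) ∷ (5 , 6) ∷ (7 , 11) ∷ (2 , 9) ∷ (0 , 14) ∷ (2 , 19) ∷ (4 , 14) ∷ (6 , 19) ∷ (8 , 14) ∷
  (10 , 19) ∷ (12 , 14) ∷ (14 , 19) ∷ (19 , 17) ∷ (17 , 12) ∷ (19 , 7) ∷ (14 , 9) ∷ (19 , 11) ∷
  (17 , 16) ∷ (15 , 11) ∷ (13 , 16) ∷ (18 , 18) ∷ (16 , 13) ∷ (11 , 11) ∷ (16 , 9) ∷ (18 , 14) ∷
  (16 , 19) ∷ (11 , 17) ∷ (16 , 15) ∷ (18 , 10) ∷ (13 , 8) ∷ (15 , 3) ∷ (10 , 1) ∷ (8 , 6) ∷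
  (3 , 4) ∷ (1 , 9) ∷ (6 , 11) ∷ (11 , 13) ∷ (6 , 15) ∷ (1 , 17) ∷ (3 , 12) ∷ (8 , 10) ∷
  (10 , 15) ∷ (15 , 17) ∷ (13 , 12) ∷ (15 , 7) ∷ (10 , 9) ∷ (8 , 4) ∷ (3 , 2) ∷ (1 , 7) ∷ (6 , 5) ∷
  (8 , 0) ∷ (10 , 5) ∷ (5 , 7) ∷ (0 , 5) ∷ (2 , 0) ∷ (4 , 5) ∷ (6 , 0) ∷ (1 , 2) ∷ (6 , 4) ∷
  (4 , 9) ∷ (9 , 11) ∷ (11 , 16) ∷ (6 , 18) ∷ (1 , 16) ∷ (3 , 11) ∷ (1 , 6) ∷ (3 , 1) ∷ (8 , 3) ∷
  (13 , 1) ∷ (18 , 3) ∷ (16 , 8) ∷ (18 , 13) ∷ (16 , 18) ∷ []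

blockBack : List Cell
blockBack =
  (4 , 19) ∷ (6 , 14) ∷ (8 , 9) ∷ (10 , 4) ∷ (12 , 9) ∷ (7 , 7) ∷ (5 , 12) ∷ (0 , 10) ∷ (2 , 15) ∷
  (7 , 17) ∷ (12 , 15) ∷ (7 , 13) ∷ (12 , 11) ∷ (7 , 9) ∷ (9 , 14) ∷ (11 , 19) ∷ (16 , 17) ∷
  (18 , 12) ∷ (16 , 7) ∷ (18 , 2) ∷ (13 , 0) ∷ (8 , 2) ∷ (13 , 4) ∷ (18 , 6) ∷ (16 , 1) ∷
  (11 , 3) ∷ (6 , 1) ∷ (1 , 3) ∷ (3 , 8) ∷ (1 , 13) ∷ (3 , 18) ∷ (5 , 13) ∷ (7 , 18) ∷ (9 , 13) ∷
  (4 , 15) ∷ (9 , 17) ∷ (14 , 15) ∷ (19 , 13) ∷ (17 , 18) ∷ (12 , 16) ∷ (7 , 14) ∷ (5 , 19) ∷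
  (3 , 14) ∷ (1 , 19) ∷ (6 , 17) ∷ (11 , 15) ∷ (9 , 10) ∷ (4 , 12) ∷ (2 , 7) ∷ (4 , 2) ∷ (6 , 7) ∷
  (11 , 5) ∷ (9 , 0) ∷ (7 , 5) ∷ (5 , 0) ∷ (0 , 2) ∷ (5 , 4) ∷ (0 , 6) ∷ (2 , 1) ∷ (4 , 6) ∷
  (9 , 4) ∷ (11 , 9) ∷ (16 , 11) ∷ (18 , 16) ∷ (13 , 14) ∷ (15 , 19) ∷ (17 , 14) ∷ (19 , 19) ∷
  (14 , 17) ∷ (19 , 15) ∷ (14 , 13) ∷ (12 , 18) ∷ (7 , 16) ∷ (2 , 14) ∷ (0 , 19) ∷ (5 , 17) ∷
  (0 , 15) ∷ (2 , 10) ∷ (7 , 12) ∷ (12 , 10) ∷ (7 , 8) ∷ (5 , 3) ∷ (0 , 1) ∷ (2 , 6) ∷ (4 , 1) ∷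
  (9 , 3) ∷ (11 , 8) ∷ (16 , 10) ∷ (18 , 15) ∷ (13 , 17) ∷ (18 , 19) ∷ (16 , 14) ∷ (11 , 12) ∷
  (13 , 7) ∷ (18 , 9) ∷ (16 , 4) ∷ (11 , 6) ∷ (6 , 8) ∷ (11 , 10) ∷ (13 , 5) ∷ (11 , 0) ∷
  (16 , 2) ∷ (11 , 4) ∷ (6 , 2) ∷ (1 , 0) ∷ (3 , 5) ∷ (1 , 10) ∷ (3 , 15) ∷ (8 , 17) ∷ (10 , 12) ∷
  (12 , 7) ∷ (14 , 12) ∷ (19 , 10) ∷ (14 , 8) ∷ (16 , 3) ∷ (18 , 8) ∷ (13 , 6) ∷ (18 , 4) ∷
  (13 , 2) ∷ (18 , 0) ∷ (16 , 5) ∷ (11 , 7) ∷ (9 , 12) ∷ (4 , 10) ∷ (9 , 8) ∷ (14 , 6) ∷ (12 , 1) ∷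
  (7 , 3) ∷ (5 , 8) ∷ (10 , 6) ∷ (8 , 1) ∷ (3 , 3) ∷ (1 , 8) ∷ (6 , 10) ∷ (8 , 15) ∷ (13 , 13) ∷
  (8 , 11) ∷ (10 , 16) ∷ (15 , 18) ∷ (17 , 13) ∷ (19 , 18) ∷ (14 , 16) ∷ (9 , 18) ∷ (4 , 16) ∷
  (2 , 11) ∷ (0 , 16) ∷ (5 , 18) ∷ (3 , 13) ∷ (1 , 18) ∷ (6 , 16) ∷ (11 , 18) ∷ (16 , 16) ∷
  (18 , 11) ∷ (16 , 6) ∷ (18 , 1) ∷ (13 , 3) ∷ (18 , 5) ∷ (16 , 0) ∷ (11 , 2) ∷ (9 , 7) ∷
  (14 , 5) ∷ (12 , 0) ∷ (17 , 2) ∷ (12 , 4) ∷ (7 , 2) ∷ (2 , 4) ∷ (0 , 9) ∷ (5 , 11) ∷ (3 , 6) ∷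
  (1 , 1) ∷ (6 , 3) ∷ (11 , 1) ∷ (9 , 6) ∷ (7 , 1) ∷ (12 , 3) ∷ (17 , 1) ∷ (19 , 6) ∷ (14 , 4) ∷
  (19 , 2) ∷ (14 , 0) ∷ (12 , 5) ∷ (14 , 10) ∷ (19 , 8) ∷ (17 , 3) ∷ (15 , 8) ∷ (10 , 10) ∷
  (15 , 12) ∷ (17 , 7) ∷ (15 , 2) ∷ (10 , 0) ∷ (8 , 5) ∷ (3 , 7) ∷ (1 , 12) ∷ (3 , 17) ∷ (8 , 19) ∷
  (10 , 14) ∷ (12 , 19) ∷ (17 , 17) ∷ (19 , 12) ∷ (14 , 14) ∷ (19 , 16) ∷ (17 , 11) ∷ (15 , 16) ∷
  (13 , 11) ∷ (15 , 6) ∷ (10 , 8) ∷ (8 , 13) ∷ (10 , 18) ∷ (5 , 16) ∷ (0 , 18) ∷ (2 , 13) ∷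
  (4 , 18) ∷ (9 , 16) ∷ (14 , 18) ∷ (12 , 13) ∷ (7 , 15) ∷ (12 , 17) ∷ (17 , 15) ∷ (15 , 10) ∷
  (13 , 15) ∷ (18 , 17) ∷ (13 , 19) ∷ (15 , 14) ∷ (17 , 19) ∷ (19 , 14) ∷ (17 , 9) ∷ (19 , 4) ∷
  (14 , 2) ∷ (19 , 0) ∷ (17 , 5) ∷ (15 , 0) ∷ (10 , 2) ∷ (15 , 4) ∷ (13 , 9) ∷ (18 , 7) ∷
  (16 , 12) ∷ (11 , 14) ∷ (9 , 19) ∷ (4 , 17) ∷ (9 , 15) ∷ (4 , 13) ∷ (2 , 18) ∷ (0 , 13) ∷
  (2 , 8) ∷ (0 , 3) ∷ (5 , 1) ∷ (7 , 6) ∷ (12 , 8) ∷ (17 , 10) ∷ (15 , 15) ∷ (13 , 10) ∷ (8 , 12) ∷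
  (10 , 7) ∷ (15 , 5) ∷ (17 , 0) ∷ (19 , 5) ∷ (14 , 7) ∷ (19 , 9) ∷ (14 , 11) ∷ (12 , 6) ∷
  (14 , 1) ∷ (19 , 3) ∷ (17 , 8) ∷ (15 , 13) ∷ (13 , 18) ∷ (8 , 16) ∷ (10 , 11) ∷ (15 , 9) ∷
  (17 , 4) ∷ (12 , 2) ∷ (7 , 4) ∷ (9 , 9) ∷ (4 , 7) ∷ (2 , 2) ∷ (7 , 0) ∷ (5 , 5) ∷ (3 , 0) ∷
  (1 , 5) ∷ (3 , 10) ∷ (1 , 15) ∷ (6 , 13) ∷ (4 , 8) ∷ (2 , 3) ∷ (0 , 8) ∷ (5 , 10) ∷ (0 , 12) ∷
  (2 , 17) ∷ (7 , 19) ∷ (5 , 14) ∷ (3 , 19) ∷ (1 , 14) ∷ (6 , 12) ∷ (8 , 7) ∷ (3 , 9) ∷ (1 , 4) ∷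
  (6 , 6) ∷ (4 , 11) ∷ (2 , 16) ∷ (0 , 11) ∷ (5 , 9) ∷ (0 , 7) ∷ (2 , 12) ∷ (0 , 17) ∷ (5 , 15) ∷
  (10 , 17) ∷ (12 , 12) ∷ (7 , 10) ∷ (9 , 5) ∷ (4 , 3) ∷ (9 , 1) ∷ []

cells20 : List Cell
cells20 =
  (14 , 3) ∷ (19 , 1) ∷ (17 , 6) ∷ (12 , 4) ∷ (14 , 9) ∷ (19 , 7) ∷ (17 , 2) ∷ (15 , 7) ∷
  (13 , 2) ∷ (18 , 0) ∷ (16 , 5) ∷ (14 , 10) ∷ (9 , 8) ∷ (4 , 10) ∷ (9 , 12) ∷ (11 , 7) ∷
  (13 , 12) ∷ (18 , 14) ∷ (16 , 19) ∷ (11 , 17) ∷ (16 , 15) ∷ (18 , 10) ∷ (13 , 8) ∷ (11 , 3) ∷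
  (16 , 1) ∷ (18 , 6) ∷ (16 , 11) ∷ (11 , 13) ∷ (9 , 18) ∷ (7 , 13) ∷ (12 , 15) ∷ (17 , 17) ∷
  (19 , 12) ∷ (17 , 7) ∷ (15 , 12) ∷ (10 , 14) ∷ (5 , 12) ∷ (0 , 14) ∷ (2 , 19) ∷ (4 , 14) ∷
  (6 , 19) ∷ (1 , 17) ∷ (6 , 15) ∷ (8 , 10) ∷ (10 , 15) ∷ (5 , 13) ∷ (7 , 18) ∷ (12 , 16) ∷
  (17 , 18) ∷ (19 , 13) ∷ (14 , 15) ∷ (12 , 10) ∷ (7 , 8) ∷ (2 , 6) ∷ (0 , 1) ∷ (5 , 3) ∷ (0 , 5) ∷
  (2 , 0) ∷ (7 , 2) ∷ (2 , 4) ∷ (0 , 9) ∷ (5 , 7) ∷ (7 , 12) ∷ (12 , 14) ∷ (10 , 19) ∷ (15 , 17) ∷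
  (17 , 12) ∷ (19 , 17) ∷ (14 , 19) ∷ (16 , 14) ∷ (18 , 19) ∷ (13 , 17) ∷ (8 , 15) ∷ (3 , 13) ∷
  (1 , 18) ∷ (6 , 16) ∷ (4 , 11) ∷ (2 , 16) ∷ (0 , 11) ∷ (5 , 9) ∷ (7 , 4) ∷ (12 , 6) ∷ (14 , 11) ∷
  (19 , 9) ∷ (17 , 4) ∷ (15 , 9) ∷ (10 , 11) ∷ (8 , 16) ∷ (3 , 18) ∷ (1 , 13) ∷ (3 , 8) ∷ (1 , 3) ∷
  (6 , 1) ∷ (4 , 6) ∷ (2 , 1) ∷ (7 , 3) ∷ (12 , 1) ∷ (14 , 6) ∷ (9 , 4) ∷ (11 , 9) ∷ (13 , 4) ∷
  (18 , 2) ∷ (13 , 0) ∷ (8 , 2) ∷ (3 , 4) ∷ (8 , 6) ∷ (10 , 1) ∷ (15 , 3) ∷ (17 , 8) ∷ (15 , 13) ∷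
  (13 , 18) ∷ (18 , 16) ∷ (13 , 14) ∷ (11 , 19) ∷ (9 , 14) ∷ (4 , 12) ∷ (2 , 17) ∷ (7 , 19) ∷
  (12 , 17) ∷ (17 , 15) ∷ (15 , 10) ∷ (10 , 12) ∷ (15 , 14) ∷ (17 , 19) ∷ (19 , 14) ∷ (17 , 9) ∷
  (19 , 4) ∷ (14 , 2) ∷ (19 , 0) ∷ (17 , 5) ∷ (12 , 3) ∷ (17 , 1) ∷ (15 , 6) ∷ (10 , 8) ∷
  (12 , 13) ∷ (14 , 8) ∷ (19 , 10) ∷ (14 , 12) ∷ (12 , 7) ∷ (7 , 9) ∷ (12 , 11) ∷ (14 , 16) ∷
  (19 , 18) ∷ (17 , 13) ∷ (19 , 8) ∷ (17 , 3) ∷ (15 , 8) ∷ (10 , 10) ∷ (12 , 5) ∷ (14 , 0) ∷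
  (19 , 2) ∷ (14 , 4) ∷ (19 , 6) ∷ (17 , 11) ∷ (15 , 16) ∷ (10 , 18) ∷ (8 , 13) ∷ (3 , 11) ∷
  (1 , 16) ∷ (6 , 18) ∷ (11 , 16) ∷ (16 , 18) ∷ (18 , 13) ∷ (13 , 11) ∷ (8 , 9) ∷ (10 , 4) ∷
  (15 , 2) ∷ (10 , 0) ∷ (8 , 5) ∷ (3 , 7) ∷ (1 , 12) ∷ (3 , 17) ∷ (8 , 19) ∷ (6 , 14) ∷ (4 , 9) ∷
  (9 , 11) ∷ (11 , 6) ∷ (16 , 4) ∷ (18 , 9) ∷ (13 , 7) ∷ (18 , 5) ∷ (16 , 0) ∷ (11 , 2) ∷ (9 , 7) ∷
  (11 , 12) ∷ (6 , 10) ∷ (1 , 8) ∷ (3 , 3) ∷ (8 , 1) ∷ (13 , 3) ∷ (18 , 1) ∷ (16 , 6) ∷ (14 , 1) ∷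
  (19 , 3) ∷ (14 , 5) ∷ (12 , 0) ∷ (10 , 5) ∷ (8 , 0) ∷ (6 , 5) ∷ (4 , 0) ∷ (2 , 5) ∷ (0 , 0) ∷
  (5 , 2) ∷ (0 , 4) ∷ (2 , 9) ∷ (4 , 4) ∷ (9 , 2) ∷ (7 , 7) ∷ (12 , 9) ∷ (7 , 11) ∷ (5 , 16) ∷
  (0 , 18) ∷ (2 , 13) ∷ (4 , 18) ∷ (9 , 16) ∷ (14 , 18) ∷ (19 , 16) ∷ (14 , 14) ∷ (12 , 19) ∷
  (7 , 17) ∷ (2 , 15) ∷ (0 , 10) ∷ (5 , 8) ∷ (0 , 6) ∷ (5 , 4) ∷ (0 , 2) ∷ (5 , 0) ∷ (3 , 5) ∷
  (1 , 0) ∷ (6 , 2) ∷ (1 , 4) ∷ (3 , 9) ∷ (8 , 7) ∷ (6 , 12) ∷ (1 , 14) ∷ (3 , 19) ∷ (5 , 14) ∷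
  (0 , 12) ∷ (2 , 7) ∷ (7 , 5) ∷ (2 , 3) ∷ (7 , 1) ∷ (9 , 6) ∷ (11 , 1) ∷ (16 , 3) ∷ (18 , 8) ∷
  (16 , 13) ∷ (18 , 18) ∷ (13 , 16) ∷ (15 , 11) ∷ (10 , 9) ∷ (8 , 4) ∷ (3 , 2) ∷ (1 , 7) ∷
  (3 , 12) ∷ (8 , 14) ∷ (6 , 9) ∷ (1 , 11) ∷ (3 , 16) ∷ (8 , 18) ∷ (10 , 13) ∷ (15 , 15) ∷
  (13 , 10) ∷ (8 , 8) ∷ (10 , 3) ∷ (15 , 1) ∷ (13 , 6) ∷ (18 , 4) ∷ (16 , 9) ∷ (11 , 11) ∷
  (6 , 13) ∷ (11 , 15) ∷ (16 , 17) ∷ (18 , 12) ∷ (16 , 7) ∷ (11 , 5) ∷ (9 , 0) ∷ (4 , 2) ∷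
  (6 , 7) ∷ (8 , 12) ∷ (10 , 7) ∷ (15 , 5) ∷ (17 , 0) ∷ (19 , 5) ∷ (14 , 7) ∷ (12 , 2) ∷ (7 , 0) ∷
  (2 , 2) ∷ (0 , 7) ∷ (5 , 5) ∷ (3 , 0) ∷ (1 , 5) ∷ (3 , 10) ∷ (1 , 15) ∷ (6 , 17) ∷ (1 , 19) ∷
  (3 , 14) ∷ (1 , 9) ∷ (6 , 11) ∷ (4 , 16) ∷ (2 , 11) ∷ (0 , 16) ∷ (5 , 18) ∷ (10 , 16) ∷
  (15 , 18) ∷ (13 , 13) ∷ (18 , 15) ∷ (16 , 10) ∷ (11 , 8) ∷ (9 , 3) ∷ (4 , 1) ∷ (6 , 6) ∷
  (11 , 4) ∷ (9 , 9) ∷ (11 , 14) ∷ (16 , 12) ∷ (18 , 7) ∷ (16 , 2) ∷ (11 , 0) ∷ (13 , 5) ∷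
  (15 , 0) ∷ (10 , 2) ∷ (15 , 4) ∷ (10 , 6) ∷ (8 , 11) ∷ (13 , 9) ∷ (18 , 11) ∷ (16 , 16) ∷
  (11 , 18) ∷ (9 , 13) ∷ (4 , 15) ∷ (9 , 17) ∷ (4 , 19) ∷ (2 , 14) ∷ (0 , 19) ∷ (5 , 17) ∷
  (0 , 15) ∷ (2 , 10) ∷ (4 , 5) ∷ (6 , 0) ∷ (1 , 2) ∷ (6 , 4) ∷ (1 , 6) ∷ (6 , 8) ∷ (1 , 10) ∷
  (3 , 15) ∷ (8 , 17) ∷ (13 , 19) ∷ (18 , 17) ∷ (13 , 15) ∷ (11 , 10) ∷ (16 , 8) ∷ (18 , 3) ∷
  (13 , 1) ∷ (8 , 3) ∷ (3 , 1) ∷ (5 , 6) ∷ (0 , 8) ∷ (5 , 10) ∷ (7 , 15) ∷ (9 , 10) ∷ (4 , 8) ∷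
  (6 , 3) ∷ (1 , 1) ∷ (3 , 6) ∷ (5 , 1) ∷ (0 , 3) ∷ (2 , 8) ∷ (7 , 10) ∷ (5 , 15) ∷ (0 , 13) ∷
  (5 , 11) ∷ (7 , 6) ∷ (12 , 8) ∷ (14 , 13) ∷ (19 , 11) ∷ (17 , 16) ∷ (12 , 18) ∷ (7 , 16) ∷
  (2 , 18) ∷ (4 , 13) ∷ (9 , 15) ∷ (4 , 17) ∷ (9 , 19) ∷ (7 , 14) ∷ (12 , 12) ∷ (17 , 10) ∷
  (19 , 15) ∷ (14 , 17) ∷ (19 , 19) ∷ (17 , 14) ∷ (15 , 19) ∷ (10 , 17) ∷ (5 , 19) ∷ (0 , 17) ∷
  (2 , 12) ∷ (4 , 7) ∷ (9 , 5) ∷ (4 , 3) ∷ (9 , 1) ∷ []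

cells30 : List Cell
cells30 =
  (14 , 3) ∷ (19 , 1) ∷ (17 , 6) ∷ (15 , 1) ∷ (13 , 6) ∷ (18 , 4) ∷ (16 , 9) ∷ (11 , 7) ∷ (6 , 9) ∷
  (1 , 11) ∷ (6 , 13) ∷ (11 , 11) ∷ (9 , 6) ∷ (4 , 4) ∷ (9 , 2) ∷ (14 , 0) ∷ (19 , 2) ∷ (14 , 4) ∷
  (12 , 9) ∷ (10 , 4) ∷ (8 , 9) ∷ (10 , 14) ∷ (8 , 19) ∷ (10 , 24) ∷ (8 , 29) ∷ (6 , 24) ∷
  (4 , 29) ∷ (2 , 24) ∷ (0 , 29) ∷ (5 , 27) ∷ (0 , 25) ∷ (5 , 23) ∷ (10 , 25) ∷ (15 , 23) ∷
  (17 , 28) ∷ (19 , 23) ∷ (14 , 25) ∷ (12 , 20) ∷ (7 , 22) ∷ (12 , 24) ∷ (14 , 29) ∷ (19 , 27) ∷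
  (17 , 22) ∷ (15 , 27) ∷ (10 , 29) ∷ (8 , 24) ∷ (3 , 26) ∷ (8 , 28) ∷ (10 , 23) ∷ (15 , 25) ∷
  (17 , 20) ∷ (19 , 25) ∷ (14 , 27) ∷ (19 , 29) ∷ (17 , 24) ∷ (15 , 19) ∷ (10 , 21) ∷ (8 , 26) ∷
  (3 , 28) ∷ (1 , 23) ∷ (6 , 25) ∷ (1 , 27) ∷ (6 , 29) ∷ (4 , 24) ∷ (2 , 29) ∷ (0 , 24) ∷
  (5 , 22) ∷ (3 , 27) ∷ (1 , 22) ∷ (3 , 17) ∷ (8 , 15) ∷ (10 , 10) ∷ (5 , 12) ∷ (7 , 7) ∷ (2 , 9) ∷
  (0 , 14) ∷ (2 , 19) ∷ (7 , 21) ∷ (5 , 26) ∷ (0 , 28) ∷ (2 , 23) ∷ (4 , 28) ∷ (9 , 26) ∷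
  (14 , 28) ∷ (19 , 26) ∷ (14 , 24) ∷ (16 , 29) ∷ (11 , 27) ∷ (9 , 22) ∷ (7 , 17) ∷ (2 , 15) ∷
  (0 , 10) ∷ (5 , 8) ∷ (0 , 6) ∷ (2 , 1) ∷ (7 , 3) ∷ (12 , 1) ∷ (14 , 6) ∷ (19 , 4) ∷ (17 , 9) ∷
  (12 , 11) ∷ (7 , 13) ∷ (12 , 15) ∷ (17 , 17) ∷ (19 , 22) ∷ (14 , 20) ∷ (19 , 18) ∷ (17 , 23) ∷
  (19 , 28) ∷ (14 , 26) ∷ (16 , 21) ∷ (18 , 26) ∷ (13 , 28) ∷ (11 , 23) ∷ (16 , 25) ∷ (18 , 20) ∷
  (13 , 18) ∷ (18 , 16) ∷ (16 , 11) ∷ (18 , 6) ∷ (16 , 1) ∷ (11 , 3) ∷ (16 , 5) ∷ (18 , 0) ∷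
  (13 , 2) ∷ (15 , 7) ∷ (17 , 2) ∷ (19 , 7) ∷ (14 , 5) ∷ (19 , 3) ∷ (14 , 1) ∷ (12 , 6) ∷ (7 , 8) ∷
  (5 , 3) ∷ (0 , 1) ∷ (2 , 6) ∷ (0 , 11) ∷ (5 , 9) ∷ (10 , 11) ∷ (12 , 16) ∷ (17 , 18) ∷
  (15 , 13) ∷ (13 , 8) ∷ (18 , 10) ∷ (16 , 15) ∷ (11 , 17) ∷ (6 , 15) ∷ (4 , 20) ∷ (2 , 25) ∷
  (0 , 20) ∷ (5 , 18) ∷ (3 , 13) ∷ (8 , 11) ∷ (6 , 6) ∷ (4 , 1) ∷ (9 , 3) ∷ (11 , 8) ∷ (9 , 13) ∷
  (4 , 11) ∷ (9 , 9) ∷ (7 , 4) ∷ (12 , 2) ∷ (17 , 0) ∷ (19 , 5) ∷ (14 , 7) ∷ (16 , 12) ∷ (18 , 7) ∷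
  (16 , 2) ∷ (11 , 4) ∷ (16 , 6) ∷ (18 , 1) ∷ (13 , 3) ∷ (8 , 1) ∷ (3 , 3) ∷ (1 , 8) ∷ (6 , 10) ∷
  (1 , 12) ∷ (3 , 7) ∷ (8 , 5) ∷ (10 , 0) ∷ (12 , 5) ∷ (17 , 3) ∷ (15 , 8) ∷ (17 , 13) ∷ (19 , 8) ∷
  (14 , 10) ∷ (19 , 12) ∷ (17 , 7) ∷ (15 , 2) ∷ (13 , 7) ∷ (15 , 12) ∷ (13 , 17) ∷ (18 , 19) ∷
  (16 , 24) ∷ (18 , 29) ∷ (13 , 27) ∷ (15 , 22) ∷ (17 , 27) ∷ (12 , 29) ∷ (7 , 27) ∷ (12 , 25) ∷
  (10 , 20) ∷ (15 , 18) ∷ (10 , 16) ∷ (15 , 14) ∷ (10 , 12) ∷ (12 , 7) ∷ (7 , 5) ∷ (5 , 0) ∷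
  (0 , 2) ∷ (2 , 7) ∷ (4 , 12) ∷ (2 , 17) ∷ (0 , 22) ∷ (2 , 27) ∷ (7 , 29) ∷ (5 , 24) ∷ (0 , 26) ∷
  (5 , 28) ∷ (7 , 23) ∷ (9 , 28) ∷ (4 , 26) ∷ (9 , 24) ∷ (4 , 22) ∷ (6 , 17) ∷ (1 , 19) ∷
  (3 , 14) ∷ (1 , 9) ∷ (3 , 4) ∷ (8 , 6) ∷ (10 , 1) ∷ (15 , 3) ∷ (17 , 8) ∷ (12 , 10) ∷ (7 , 12) ∷
  (2 , 10) ∷ (4 , 15) ∷ (9 , 17) ∷ (11 , 22) ∷ (9 , 27) ∷ (4 , 25) ∷ (9 , 23) ∷ (7 , 28) ∷
  (12 , 26) ∷ (14 , 21) ∷ (19 , 19) ∷ (17 , 14) ∷ (15 , 9) ∷ (17 , 4) ∷ (19 , 9) ∷ (14 , 11) ∷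
  (19 , 13) ∷ (14 , 15) ∷ (19 , 17) ∷ (17 , 12) ∷ (12 , 14) ∷ (14 , 19) ∷ (19 , 21) ∷ (17 , 26) ∷
  (15 , 21) ∷ (17 , 16) ∷ (15 , 11) ∷ (13 , 16) ∷ (8 , 14) ∷ (10 , 19) ∷ (15 , 17) ∷ (13 , 22) ∷
  (8 , 20) ∷ (3 , 22) ∷ (1 , 17) ∷ (3 , 12) ∷ (1 , 7) ∷ (3 , 2) ∷ (8 , 4) ∷ (10 , 9) ∷ (5 , 7) ∷
  (0 , 5) ∷ (2 , 0) ∷ (4 , 5) ∷ (9 , 7) ∷ (4 , 9) ∷ (6 , 4) ∷ (1 , 2) ∷ (6 , 0) ∷ (11 , 2) ∷
  (16 , 0) ∷ (18 , 5) ∷ (16 , 10) ∷ (18 , 15) ∷ (13 , 13) ∷ (18 , 11) ∷ (13 , 9) ∷ (15 , 4) ∷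
  (10 , 6) ∷ (5 , 4) ∷ (7 , 9) ∷ (2 , 11) ∷ (4 , 16) ∷ (9 , 14) ∷ (11 , 9) ∷ (13 , 4) ∷ (8 , 2) ∷
  (10 , 7) ∷ (8 , 12) ∷ (10 , 17) ∷ (5 , 15) ∷ (0 , 17) ∷ (5 , 19) ∷ (0 , 21) ∷ (2 , 26) ∷
  (4 , 21) ∷ (9 , 19) ∷ (11 , 14) ∷ (16 , 16) ∷ (11 , 18) ∷ (16 , 20) ∷ (18 , 25) ∷ (13 , 23) ∷
  (15 , 28) ∷ (10 , 26) ∷ (8 , 21) ∷ (3 , 19) ∷ (8 , 17) ∷ (3 , 15) ∷ (1 , 20) ∷ (6 , 22) ∷
  (1 , 24) ∷ (3 , 29) ∷ (8 , 27) ∷ (13 , 25) ∷ (15 , 20) ∷ (10 , 22) ∷ (15 , 24) ∷ (17 , 29) ∷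
  (19 , 24) ∷ (17 , 19) ∷ (12 , 21) ∷ (7 , 19) ∷ (2 , 21) ∷ (0 , 16) ∷ (5 , 14) ∷ (0 , 12) ∷
  (5 , 10) ∷ (0 , 8) ∷ (5 , 6) ∷ (0 , 4) ∷ (5 , 2) ∷ (0 , 0) ∷ (2 , 5) ∷ (4 , 0) ∷ (6 , 5) ∷
  (8 , 0) ∷ (10 , 5) ∷ (12 , 0) ∷ (7 , 2) ∷ (12 , 4) ∷ (7 , 6) ∷ (2 , 4) ∷ (0 , 9) ∷ (2 , 14) ∷
  (0 , 19) ∷ (5 , 21) ∷ (7 , 26) ∷ (12 , 28) ∷ (14 , 23) ∷ (16 , 18) ∷ (11 , 20) ∷ (9 , 25) ∷
  (4 , 27) ∷ (2 , 22) ∷ (4 , 17) ∷ (9 , 15) ∷ (11 , 10) ∷ (6 , 8) ∷ (4 , 3) ∷ (2 , 8) ∷ (4 , 13) ∷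
  (2 , 18) ∷ (0 , 13) ∷ (5 , 11) ∷ (10 , 13) ∷ (15 , 15) ∷ (13 , 10) ∷ (18 , 8) ∷ (16 , 3) ∷
  (11 , 1) ∷ (6 , 3) ∷ (1 , 1) ∷ (3 , 6) ∷ (8 , 8) ∷ (3 , 10) ∷ (1 , 15) ∷ (3 , 20) ∷ (1 , 25) ∷
  (6 , 27) ∷ (1 , 29) ∷ (3 , 24) ∷ (8 , 22) ∷ (10 , 27) ∷ (15 , 29) ∷ (13 , 24) ∷ (11 , 29) ∷
  (16 , 27) ∷ (18 , 22) ∷ (16 , 17) ∷ (18 , 12) ∷ (13 , 14) ∷ (11 , 19) ∷ (6 , 21) ∷ (8 , 16) ∷
  (6 , 11) ∷ (1 , 13) ∷ (3 , 18) ∷ (5 , 13) ∷ (10 , 15) ∷ (5 , 17) ∷ (0 , 15) ∷ (2 , 20) ∷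
  (7 , 18) ∷ (2 , 16) ∷ (7 , 14) ∷ (12 , 12) ∷ (7 , 10) ∷ (12 , 8) ∷ (10 , 3) ∷ (5 , 1) ∷ (0 , 3) ∷
  (5 , 5) ∷ (3 , 0) ∷ (1 , 5) ∷ (6 , 7) ∷ (4 , 2) ∷ (9 , 0) ∷ (11 , 5) ∷ (16 , 7) ∷ (18 , 2) ∷
  (13 , 0) ∷ (15 , 5) ∷ (17 , 10) ∷ (19 , 15) ∷ (14 , 17) ∷ (12 , 22) ∷ (7 , 20) ∷ (12 , 18) ∷
  (7 , 16) ∷ (9 , 11) ∷ (11 , 16) ∷ (6 , 18) ∷ (8 , 13) ∷ (10 , 18) ∷ (15 , 16) ∷ (17 , 11) ∷
  (12 , 13) ∷ (7 , 11) ∷ (5 , 16) ∷ (0 , 18) ∷ (2 , 13) ∷ (4 , 18) ∷ (9 , 16) ∷ (11 , 21) ∷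
  (6 , 23) ∷ (8 , 18) ∷ (3 , 16) ∷ (1 , 21) ∷ (6 , 19) ∷ (4 , 14) ∷ (9 , 12) ∷ (4 , 10) ∷ (9 , 8) ∷
  (11 , 13) ∷ (9 , 18) ∷ (14 , 16) ∷ (19 , 14) ∷ (14 , 12) ∷ (19 , 10) ∷ (17 , 15) ∷ (19 , 20) ∷
  (17 , 25) ∷ (12 , 27) ∷ (7 , 25) ∷ (5 , 20) ∷ (3 , 25) ∷ (8 , 23) ∷ (10 , 28) ∷ (12 , 23) ∷
  (14 , 18) ∷ (19 , 16) ∷ (14 , 14) ∷ (12 , 19) ∷ (17 , 21) ∷ (15 , 26) ∷ (13 , 21) ∷ (18 , 23) ∷
  (16 , 28) ∷ (11 , 26) ∷ (6 , 28) ∷ (1 , 26) ∷ (3 , 21) ∷ (1 , 16) ∷ (3 , 11) ∷ (1 , 6) ∷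
  (3 , 1) ∷ (8 , 3) ∷ (10 , 8) ∷ (15 , 10) ∷ (13 , 15) ∷ (18 , 13) ∷ (13 , 11) ∷ (18 , 9) ∷
  (16 , 14) ∷ (11 , 12) ∷ (6 , 14) ∷ (4 , 19) ∷ (9 , 21) ∷ (4 , 23) ∷ (2 , 28) ∷ (0 , 23) ∷
  (5 , 25) ∷ (0 , 27) ∷ (5 , 29) ∷ (7 , 24) ∷ (9 , 29) ∷ (11 , 24) ∷ (13 , 29) ∷ (18 , 27) ∷
  (16 , 22) ∷ (18 , 17) ∷ (13 , 19) ∷ (18 , 21) ∷ (16 , 26) ∷ (11 , 28) ∷ (6 , 26) ∷ (1 , 28) ∷
  (3 , 23) ∷ (8 , 25) ∷ (6 , 20) ∷ (1 , 18) ∷ (6 , 16) ∷ (1 , 14) ∷ (3 , 9) ∷ (1 , 4) ∷ (6 , 2) ∷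
  (1 , 0) ∷ (3 , 5) ∷ (1 , 10) ∷ (6 , 12) ∷ (4 , 7) ∷ (2 , 12) ∷ (0 , 7) ∷ (2 , 2) ∷ (7 , 0) ∷
  (9 , 5) ∷ (11 , 0) ∷ (13 , 5) ∷ (8 , 7) ∷ (10 , 2) ∷ (15 , 0) ∷ (17 , 5) ∷ (19 , 0) ∷ (14 , 2) ∷
  (9 , 4) ∷ (4 , 6) ∷ (6 , 1) ∷ (1 , 3) ∷ (3 , 8) ∷ (8 , 10) ∷ (13 , 12) ∷ (18 , 14) ∷ (16 , 19) ∷
  (18 , 24) ∷ (13 , 26) ∷ (18 , 28) ∷ (16 , 23) ∷ (11 , 25) ∷ (13 , 20) ∷ (18 , 18) ∷ (16 , 13) ∷
  (11 , 15) ∷ (9 , 20) ∷ (14 , 22) ∷ (12 , 17) ∷ (7 , 15) ∷ (9 , 10) ∷ (4 , 8) ∷ (2 , 3) ∷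
  (7 , 1) ∷ (12 , 3) ∷ (14 , 8) ∷ (19 , 6) ∷ (17 , 1) ∷ (15 , 6) ∷ (13 , 1) ∷ (18 , 3) ∷ (16 , 8) ∷
  (14 , 13) ∷ (19 , 11) ∷ (14 , 9) ∷ (16 , 4) ∷ (11 , 6) ∷ (9 , 1) ∷ []

blockFront-path : KnightPath start (16 , 18) blockFront
blockFront-path = from-yes (knightPath? start (16 , 18) blockFront)

blockBack-path : KnightPath (4 , 19) end blockBack
blockBack-path = from-yes (knightPath? (4 , 19) end blockBack)

block-enumerates : EnumeratesBoard 20 20 (blockFront ++ blockBack)
block-enumerates = from-yes (enumeratesBoard? 20 20 (blockFront ++ blockBack))

extend : ∀ {q} → HamiltonianKnightPath 20 q start end → HamiltonianKnightPath 20 (20 + q) start end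
extend = HamiltonianKnightPath-splice 20 blockFront-path blockBack-path block-enumerates
  (inj₁ (refl , refl)) (inj₂ (refl , refl))

hamiltonianPath20 : HamiltonianKnightPath 20 20 start end
hamiltonianPath20 =
  cells20 , from-yes (knightPath? start end cells20) , from-yes (enumeratesBoard? 20 20 cells20)

hamiltonianPath30 : HamiltonianKnightPath 20 30 start end
hamiltonianPath30 =
  cells30 , from-yes (knightPath? start end cells30) , from-yes (enumeratesBoard? 20 30 cells30)

width : ℕ → ℕ
width 0             = 20
width 1             = 30
width (suc (suc j)) = 20 + width j

width≡ : ∀ j → width j ≡ 10 * (2 + j)
width≡ 0             = refl
width≡ 1             = refl
width≡ (suc (suc j)) = trans (cong (20 +_) (width≡ j)) (sym (*-distribˡ-+ 10 2 (2 + j)))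

hamiltonianPath : ∀ j → HamiltonianKnightPath 20 (width j) start end
hamiltonianPath 0             = hamiltonianPath20
hamiltonianPath 1             = hamiltonianPath30
hamiltonianPath (suc (suc j)) = extend (hamiltonianPath j)

-- Each of these cell lists visibly starts with a concrete prefix (cells20, cells30 or blockFront).
hamiltonianPath-long : ∀ j → 3 ≤ length (proj₁ (hamiltonianPath j))
hamiltonianPath-long 0             = s≤s (s≤s (s≤s z≤n))
hamiltonianPath-long 1             = s≤s (s≤s (s≤s z≤n))
hamiltonianPath-long (suc (suc j)) = s≤s (s≤s (s≤s z≤n))

lemma17 : (k : ℕ) → 2 ≤ k → Knight25Tour 20 (10 * k)
lemma17 1             (s≤s ())
lemma17 (suc (suc j)) _ =
  subst (Knight25Tour 20) (width≡ j)
    (knightTour (hamiltonianPath j) (hamiltonianPath-long j) (inj₂ (refl , refl)))
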